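{- For every integer $n\ge 1$, the $2_0$-Dyck paths of length $3n$ having exactly $n-1$ down-steps at a height of $1$ modulo $2$ and exactly one down-step at a height of $2$ modulo $2$ are in bijection with Dyck paths of length $2n-2$; in particular their number is the Catalan number $\frac{1}{n}\binom{2n-2}{n-1}$.
   Context: For non-negative integers $k,t,n$ with $0\le t<k$, a $k_t$-Dyck path of length $(k+1)n$ is a lattice path consisting of $n$ down-steps $(1,-k)$ and $kn$ up-steps $(1,1)$ that starts at $(0,0)$, ends at $((k+1)n,0)$, and stays weakly above the line $y=-t$. A down-step is at a height of $i$ modulo $k$ if its endpoint's $y$-coordinate is congruent to $i$ modulo $k$. A Dyck path of length $2m$ is a path of $m$ steps $(1,1)$ and $m$ steps $(1,-1)$ from $(0,0)$ to $(2m,0)$ staying weakly above the $x$-axis. -}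

module Defs where

open import Data.Bool using (Bool; true; false; _∧_)
open import Data.Nat as ℕ using (ℕ; zero; suc; NonZero)
open import Data.Integer as ℤ using (ℤ; +_; -_; _%ℕ_)
open import Data.List using (List; []; _∷_; length; filter)
open import Data.Vec using (Vec; toList)
open import Data.Product using (Σ; _×_; _,_; proj₁; proj₂)
open import Data.Unit using (⊤)
open import Relation.Nullary.Decidable using (⌊_⌋)

allB : {A : Set} → (A → Bool) → List A → Bool
allB b []       = true
allB b (x ∷ xs) = b x ∧ allB b xs

-- A step of a lattice path: U = up-step (1,1), D = down-step (1,-k).
data Step : Set where
  U D : Step

endpoints : (k : ℕ) → ℤ → List Step → List (Step × ℤ)
endpoints k h []      = []
endpoints k h (U ∷ s) = (U , h ℤ.+ + 1) ∷ endpoints k (h ℤ.+ + 1) s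
endpoints k h (D ∷ s) = (D , h ℤ.- + k) ∷ endpoints k (h ℤ.- + k) s

finalHeight : (k : ℕ) → ℤ → List Step → ℤ
finalHeight k h []      = h
finalHeight k h (U ∷ s) = finalHeight k (h ℤ.+ + 1) s
finalHeight k h (D ∷ s) = finalHeight k (h ℤ.- + k) s

isU : Step → Bool
isU U = true
isU D = false

isD : Step → Bool
isD U = false
isD D = true

countU countD : List Step → ℕ
countU s = length (filter (λ x → isU x Data.Bool.≟ true) s)
countD s = length (filter (λ x → isD x Data.Bool.≟ true) s)

isKTDyck : (k t n : ℕ) → Vec Step (suc k ℕ.* n) → Bool
isKTDyck k t n p =
  ⌊ countD (toList p) ℕ.≟ n ⌋ ∧
  ⌊ countU (toList p) ℕ.≟ k ℕ.* n ⌋ ∧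
  ⌊ finalHeight k (+ 0) (toList p) ℤ.≟ + 0 ⌋ ∧
  allB (λ e → ⌊ (- (+ t)) ℤ.≤? proj₂ e ⌋) (endpoints k (+ 0) (toList p))

KTDyckPath : (k t n : ℕ) → Set
KTDyckPath k t n = Σ (Vec Step (suc k ℕ.* n)) (λ p → Data.Bool.T (isKTDyck k t n p))

-- Number of down-steps of p at a height of i modulo k
-- (endpoint y-coordinate y with y ≡ i (mod k), i.e. (y - i) mod k = 0).
downsAtHeight : (k i : ℕ) .{{_ : NonZero k}} → List Step → ℕ
downsAtHeight k i s =
  length (filter (λ e → isD (proj₁ e) Data.Bool.≟ true) 
           (filter (λ e → ((proj₂ e ℤ.- + i) %ℕ k) ℕ.≟ 0) (endpoints k (+ 0) s)))

isDyck : (m : ℕ) → Vec Step (2 ℕ.* m) → Bool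
isDyck m p =
  ⌊ countD (toList p) ℕ.≟ m ⌋ ∧
  ⌊ countU (toList p) ℕ.≟ m ⌋ ∧
  ⌊ finalHeight 1 (+ 0) (toList p) ℤ.≟ + 0 ⌋ ∧
  allB (λ e → ⌊ + 0 ℤ.≤? proj₂ e ⌋) (endpoints 1 (+ 0) (toList p))

DyckPath : (m : ℕ) → Set
DyckPath m = Σ (Vec Step (2 ℕ.* m)) (λ p → Data.Bool.T (isDyck m p))

SpecialPath : (n : ℕ) → Set
SpecialPath n = Σ (KTDyckPath 2 0 n) λ P →
  Data.Bool.T (⌊ downsAtHeight 2 1 (toList (proj₁ P)) ℕ.≟ n ℕ.∸ 1 ⌋ ∧
               ⌊ downsAtHeight 2 2 (toList (proj₁ P)) ℕ.≟ 1 ⌋)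

-- Doubling every up-step of a Dyck path w turns a height h into 2h + 1, so in
-- U · double w · U D (a 2₀-Dyck path of length 3(m+1) when w has length 2m) every
-- down-step of double w ends at an odd height and the final D is the only one ending
-- at an even height. Conversely, read from an odd height 2h + 1, a 2₀-path with a
-- single even down-step starts with D (to 2h − 1), with U U (to 2h + 3), or with the
-- even down-step U D, which must then be its last step since the last down-step of a
-- path ends at 0; this peels off w step by step. Dyck paths are then counted by the
-- ballot formula, and absorption turns C(2m,m) − C(2m,m+1) into C(2m,m)/(m+1).

module Submission where

open import Defs
open import Data.Bool as Bool using (Bool; true; false; T; _∧_; not; if_then_else_)
open import Data.Bool.Properties using (T-irrelevant; ∧-zeroʳ; not-involutive)
open import Data.Empty using (⊥-elim)
import Data.Fin as Fin
open import Data.Fin using (Fin)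
open import Data.Fin.Properties using (+↔⊎)
open import Data.Integer as ℤ using (_⊖_; _%ℕ_)
open import Data.Integer.Properties using ([+m]-[+n]≡m⊖n; [1+m]⊖[1+n]≡m⊖n; ⊖-≥)
open import Data.List using (List; []; _∷_; length; filter; _++_)
open import Data.List.Properties using (++-cancelʳ; ∷-injectiveʳ; length-++)
open import Data.Nat as ℕ using (ℕ; zero; suc; _+_; _*_; _∸_; _/_; _≤_; _<_; z≤n; s≤s; NonZero)
open import Data.Nat.Properties
open import Data.Nat.Combinatorics using (_C_; nCk+nC[k+1]≡[n+1]C[k+1]; nCk≡nC[n∸k]; nC1≡n)
open import Data.Nat.DivMod using (m*n/n≡m)
open import Data.Nat.Tactic.RingSolver using (solve-∀)
open import Data.Product using (Σ; _×_; _,_; proj₁; proj₂)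
open import Data.Product.Function.Dependent.Propositional as Σ using ()
open import Data.Product.Properties using (Σ-≡,≡→≡)
open import Data.Sum using (_⊎_; inj₁; inj₂)
open import Data.Sum.Function.Propositional using (_⊎-↔_)
open import Data.Vec using (Vec; []; _∷_; toList)
open import Data.Vec.Properties using (length-toList)
open import Function.Base using (_∘_)
open import Function.Bundles using (_↔_; _⤖_; _⇔_; mk↔ₛ′; mk⇔; Equivalence)
open Equivalence using (to; from)
open import Function.Construct.Composition using (_↔-∘_)
open import Function.Construct.Identity using (↔-id)
open import Function.Construct.Symmetry using (↔-sym)
open import Function.Properties.Inverse using (↔⇒⤖)
open import Function.Related.Propositional using (module EquationalReasoning)
open import Function.Related.TypeIsomorphisms using (Σ-assoc)
open import Relation.Binary.PropositionalEquality
open import Relation.Nullary.Decidable using (Dec; yes; no; ⌊_⌋)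
open import Relation.Nullary.Irrelevant using (Irrelevant)

×-irrelevant : {A B : Set} → Irrelevant A → Irrelevant B → Irrelevant (A × B)
×-irrelevant A-irr B-irr (a , b) (a′ , b′) = cong₂ _,_ (A-irr a a′) (B-irr b b′)

module _ {A B : Set} {P : A → Set} {Q : B → Set}
         (P-irr : ∀ {a} → Irrelevant (P a)) (Q-irr : ∀ {b} → Irrelevant (Q b)) where

  restriction-↔ : (f : A → B) → (∀ {a} → P a → Q (f a)) →
                  (∀ {a a′} → f a ≡ f a′ → a ≡ a′) →
                  (∀ {b} → Q b → Σ A λ a → P a × f a ≡ b) →
                  Σ A P ↔ Σ B Q
  restriction-↔ f f-pres f-inj f-onto = mk↔ₛ′ φ ψ φ∘ψ ψ∘φ
    where
    φ : Σ A P → Σ B Q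
    φ (a , p) = f a , f-pres p
    ψ : Σ B Q → Σ A P
    ψ (b , q) = proj₁ (f-onto q) , proj₁ (proj₂ (f-onto q))
    φ∘ψ : ∀ y → φ (ψ y) ≡ y
    φ∘ψ (b , q) = Σ-≡,≡→≡ (proj₂ (proj₂ (f-onto q)) , Q-irr _ _)
    ψ∘φ : ∀ x → ψ (φ x) ≡ x
    ψ∘φ (a , p) = Σ-≡,≡→≡ (f-inj (proj₂ (proj₂ (f-onto (f-pres p)))) , P-irr _ _)

module _ {A : Set} {P Q : A → Set}
         (P-irr : ∀ {a} → Irrelevant (P a)) (Q-irr : ∀ {a} → Irrelevant (Q a)) where

  Σ-cong-⇔ : (∀ {a} → P a ⇔ Q a) → Σ A P ↔ Σ A Q
  Σ-cong-⇔ P⇔Q = restriction-↔ P-irr Q-irr (λ a → a) (to P⇔Q) (λ eq → eq)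
    (λ q → _ , from P⇔Q q , refl)

⌊⌋∧⌊⌋∧-implied : ∀ {A B : Set} (a? : Dec A) (b? : Dec B) c → (T c → A) → (T c → B) → ⌊ a? ⌋ ∧ ⌊ b? ⌋ ∧ c ≡ c
⌊⌋∧⌊⌋∧-implied (yes _) (yes _) c     _    _    = refl
⌊⌋∧⌊⌋∧-implied (yes _) (no _)  false _    _    = refl
⌊⌋∧⌊⌋∧-implied (yes _) (no ¬b) true  _    c⇒b = ⊥-elim (¬b (c⇒b _))
⌊⌋∧⌊⌋∧-implied (no _)  _       false _    _    = refl
⌊⌋∧⌊⌋∧-implied (no ¬a) _       true  c⇒a _    = ⊥-elim (¬a (c⇒a _))

T-⌊⌋∧⌊⌋ : ∀ {A B : Set} (a? : Dec A) (b? : Dec B) → T (⌊ a? ⌋ ∧ ⌊ b? ⌋) ⇔ (A × B)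
T-⌊⌋∧⌊⌋ (yes a) (yes b) = mk⇔ (λ _ → a , b) _
T-⌊⌋∧⌊⌋ (yes _) (no ¬b)  = mk⇔ (λ ()) (λ (_ , b) → ¬b b)
T-⌊⌋∧⌊⌋ (no ¬a) _        = mk⇔ (λ ()) (λ (a , _) → ¬a a)

module _ {A : Set} where

  fromList≡ : ∀ {n} (xs : List A) → length xs ≡ n → Vec A n
  fromList≡ {zero}  []       _  = []
  fromList≡ {suc n} (x ∷ xs) eq = x ∷ fromList≡ xs (suc-injective eq)

  Vec↔List : ∀ {n} → Vec A n ↔ Σ (List A) (λ xs → length xs ≡ n)
  Vec↔List {n} = mk↔ₛ′ (λ v → toList v , length-toList v) (λ (xs , eq) → fromList≡ xs eq)
    (λ (xs , eq) → Σ-≡,≡→≡ (toList∘fromList≡ xs eq , ≡-irrelevant _ _)) (λ v → fromList≡∘toList v _)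
    where
    toList∘fromList≡ : ∀ {n} xs (eq : length xs ≡ n) → toList (fromList≡ xs eq) ≡ xs
    toList∘fromList≡ {zero}  []       _  = refl
    toList∘fromList≡ {suc n} (x ∷ xs) eq = cong (x ∷_) (toList∘fromList≡ xs (suc-injective eq))
    fromList≡∘toList : ∀ {n} (v : Vec A n) (eq : length (toList v) ≡ n) → fromList≡ (toList v) eq ≡ v
    fromList≡∘toList []      _  = refl
    fromList≡∘toList (x ∷ v) eq = cong (x ∷_) (fromList≡∘toList v (suc-injective eq))

  Σ-Vec↔Σ-List : ∀ {n} (P : List A → Set) →
                 Σ (Vec A n) (P ∘ toList) ↔ Σ (List A) (λ xs → length xs ≡ n × P xs)
  Σ-Vec↔Σ-List P = Σ-assoc ↔-∘ Σ.cong {B = P ∘ proj₁} Vec↔List (↔-id _)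

count : (N : ℕ) → (Vec Step N → Bool) → ℕ
count zero    P = if P [] then 1 else 0
count (suc N) P = count N (P ∘ (U ∷_)) + count N (P ∘ (D ∷_))

count-false : ∀ N → count N (λ _ → false) ≡ 0
count-false zero    = refl
count-false (suc N) = cong₂ _+_ (count-false N) (count-false N)

T↔Fin : ∀ b → T b ↔ Fin (if b then 1 else 0)
T↔Fin true  = mk↔ₛ′ (λ _ → Fin.zero) _ (λ { Fin.zero → refl ; (Fin.suc ()) }) (λ _ → refl)
T↔Fin false = mk↔ₛ′ (λ ()) (λ ()) (λ ()) (λ ())

enumerate : ∀ N (P : Vec Step N → Bool) → Σ (Vec Step N) (T ∘ P) ↔ Fin (count N P)
enumerate zero    P = T↔Fin (P []) ↔-∘ mk↔ₛ′ (λ { ([] , p) → p }) ([] ,_) (λ _ → refl) (λ { ([] , _) → refl })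
enumerate (suc N) P = ↔-sym +↔⊎ ↔-∘ ((enumerate N _ ⊎-↔ enumerate N _) ↔-∘ split)
  where
  split : Σ (Vec Step (suc N)) (T ∘ P) ↔ (Σ (Vec Step N) (T ∘ P ∘ (U ∷_)) ⊎ Σ (Vec Step N) (T ∘ P ∘ (D ∷_)))
  split = mk↔ₛ′ (λ { (U ∷ v , p) → inj₁ (v , p) ; (D ∷ v , p) → inj₂ (v , p) })
                (λ { (inj₁ (v , p)) → U ∷ v , p ; (inj₂ (v , p)) → D ∷ v , p })
                (λ { (inj₁ _) → refl ; (inj₂ _) → refl })
                (λ { (U ∷ v , p) → refl ; (D ∷ v , p) → refl })

-- Lattice paths with heights in ℕ

≤ᵇ≡true⇒≤ : ∀ k h → (k ℕ.≤ᵇ h) ≡ true → k ≤ h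
≤ᵇ≡true⇒≤ k h eq = ≤ᵇ⇒≤ k h (subst T (sym eq) _)

dyckFrom : (k h : ℕ) → List Step → Bool
dyckFrom k h []      = h ℕ.≡ᵇ 0
dyckFrom k h (U ∷ s) = dyckFrom k (suc h) s
dyckFrom k h (D ∷ s) = (k ℕ.≤ᵇ h) ∧ dyckFrom k (h ∸ k) s

nonNegative-⊖ : ∀ h k → ⌊ ℤ.+ 0 ℤ.≤? h ⊖ k ⌋ ≡ (k ℕ.≤ᵇ h)
nonNegative-⊖ zero    zero    = refl
nonNegative-⊖ (suc h) zero    = refl
nonNegative-⊖ zero    (suc k) = refl
nonNegative-⊖ (suc h) (suc zero)    = refl
nonNegative-⊖ (suc h) (suc (suc k)) =
  trans (cong (λ z → ⌊ ℤ.+ 0 ℤ.≤? z ⌋) ([1+m]⊖[1+n]≡m⊖n h (suc k))) (nonNegative-⊖ h (suc k))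

+h+1≡+[1+h] : ∀ h → ℤ.+ h ℤ.+ ℤ.+ 1 ≡ ℤ.+ suc h
+h+1≡+[1+h] h = cong ℤ.+_ (+-comm h 1)

dyckFrom-correct : ∀ k h s →
  ⌊ finalHeight k (ℤ.+ h) s ℤ.≟ ℤ.+ 0 ⌋ ∧ allB (λ e → ⌊ ℤ.+ 0 ℤ.≤? proj₂ e ⌋) (endpoints k (ℤ.+ h) s) ≡ dyckFrom k h s
dyckFrom-correct k zero    []      = refl
dyckFrom-correct k (suc h) []      = refl
dyckFrom-correct k h       (U ∷ s) rewrite +h+1≡+[1+h] h = dyckFrom-correct k (suc h) s
dyckFrom-correct k h       (D ∷ s) rewrite [+m]-[+n]≡m⊖n h k | nonNegative-⊖ h k with k ℕ.≤ᵇ h in k≤ᵇh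
... | true  rewrite ⊖-≥ (≤ᵇ≡true⇒≤ k h k≤ᵇh) = dyckFrom-correct k (h ∸ k) s
... | false = ∧-zeroʳ _

countU+countD≡length : ∀ s → countU s + countD s ≡ length s
countU+countD≡length []      = refl
countU+countD≡length (U ∷ s) = cong suc (countU+countD≡length s)
countU+countD≡length (D ∷ s) = trans (+-suc (countU s) (countD s)) (cong suc (countU+countD≡length s))

dyckFrom-balance : ∀ k h s → T (dyckFrom k h s) → countU s + h ≡ k * countD s
dyckFrom-balance k zero []      _ = sym (*-zeroʳ k)
dyckFrom-balance k h    (U ∷ s) p = trans (sym (+-suc (countU s) h)) (dyckFrom-balance k (suc h) s p)
dyckFrom-balance k h    (D ∷ s) p with k ℕ.≤ᵇ h in k≤ᵇh
... | true = begin
  countU s + h                  ≡⟨ cong (countU s +_) (m∸n+n≡m (≤ᵇ≡true⇒≤ k h k≤ᵇh)) ⟨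
  countU s + (h ∸ k + k)        ≡⟨ +-assoc (countU s) (h ∸ k) k ⟨
  countU s + (h ∸ k) + k        ≡⟨ cong (_+ k) (dyckFrom-balance k (h ∸ k) s p) ⟩
  k * countD s + k              ≡⟨ +-comm (k * countD s) k ⟩
  k + k * countD s              ≡⟨ *-suc k (countD s) ⟨
  k * suc (countD s)            ∎
  where open ≡-Reasoning

dyckFrom-counts : ∀ k n s → length s ≡ suc k * n → T (dyckFrom k 0 s) → countD s ≡ n × countU s ≡ k * n
dyckFrom-counts k n s len p = countD≡n , trans countU≡k*countD (cong (k *_) countD≡n)
  where
  countU≡k*countD : countU s ≡ k * countD s
  countU≡k*countD = trans (sym (+-identityʳ _)) (dyckFrom-balance k 0 s p)
  countD≡n : countD s ≡ n
  countD≡n = *-cancelˡ-≡ _ _ (suc k) (begin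
    suc k * countD s        ≡⟨⟩
    countD s + k * countD s ≡⟨ cong (countD s +_) countU≡k*countD ⟨
    countD s + countU s     ≡⟨ +-comm (countD s) _ ⟩
    countU s + countD s     ≡⟨ countU+countD≡length s ⟩
    length s                ≡⟨ len ⟩
    suc k * n               ∎)
    where open ≡-Reasoning

downsWhere : (ℕ → Bool) → (k h : ℕ) → List Step → ℕ
downsWhere P k h []      = 0
downsWhere P k h (U ∷ s) = downsWhere P k (suc h) s
downsWhere P k h (D ∷ s) = (if P (h ∸ k) then 1 else 0) + downsWhere P k (h ∸ k) s

downsWhere-cong : ∀ {P Q} k h s → (∀ y → P y ≡ Q y) → downsWhere P k h s ≡ downsWhere Q k h s
downsWhere-cong k h []      P≗Q = refl
downsWhere-cong k h (U ∷ s) P≗Q = downsWhere-cong k (suc h) s P≗Q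
downsWhere-cong k h (D ∷ s) P≗Q =
  cong₂ (λ b n → (if b then 1 else 0) + n) (P≗Q (h ∸ k)) (downsWhere-cong k (h ∸ k) s P≗Q)

downsWhere+downsWhere-not : ∀ P k h s → downsWhere P k h s + downsWhere (not ∘ P) k h s ≡ countD s
downsWhere+downsWhere-not P k h []      = refl
downsWhere+downsWhere-not P k h (U ∷ s) = downsWhere+downsWhere-not P k (suc h) s
downsWhere+downsWhere-not P k h (D ∷ s) with P (h ∸ k)
... | true  = cong suc (downsWhere+downsWhere-not P k (h ∸ k) s)
... | false = trans (+-suc _ _) (cong suc (downsWhere+downsWhere-not P k (h ∸ k) s))

-- The last step is a down-step ending at height 0.
downsWhere-positive : ∀ P k h x s → T (P 0) → T (dyckFrom k h (x ∷ s)) → 0 < downsWhere P k h (x ∷ s)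
downsWhere-positive P k h U (y ∷ s) P0 p = downsWhere-positive P k (suc h) y s P0 p
downsWhere-positive P k h D s P0 p with k ℕ.≤ᵇ h
downsWhere-positive P k h D [] P0 p | true rewrite ≡ᵇ⇒≡ (h ∸ k) 0 p with P 0
... | true = s≤s z≤n
downsWhere-positive P k h D (y ∷ s) P0 p | true =
  ≤-trans (downsWhere-positive P k (h ∸ k) y s P0 p) (m≤n+m _ _)

-- The form to which Defs' test ((y − i) %ℕ k ≟ 0) reduces inside filter.
atHeight : (k i : ℕ) .{{_ : NonZero k}} → ℕ → Bool
atHeight k i y = (ℤ.+ y ℤ.- ℤ.+ i) %ℕ k ℕ.≡ᵇ 0

downsAtHeightFrom : (k i : ℕ) .{{_ : NonZero k}} → ℕ → List Step → ℕ
downsAtHeightFrom k i h s =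
  length (filter (λ e → isD (proj₁ e) Bool.≟ true)
           (filter (λ e → ((proj₂ e ℤ.- ℤ.+ i) %ℕ k) ℕ.≟ 0) (endpoints k (ℤ.+ h) s)))

downsAtHeightFrom≡downsWhere : ∀ k i .{{_ : NonZero k}} h s → T (dyckFrom k h s) →
                               downsAtHeightFrom k i h s ≡ downsWhere (atHeight k i) k h s
downsAtHeightFrom≡downsWhere k i h []      _ = refl
downsAtHeightFrom≡downsWhere k i h (U ∷ s) p rewrite +h+1≡+[1+h] h with atHeight k i (suc h)
... | true  = downsAtHeightFrom≡downsWhere k i (suc h) s p
... | false = downsAtHeightFrom≡downsWhere k i (suc h) s p
downsAtHeightFrom≡downsWhere k i h (D ∷ s) p rewrite [+m]-[+n]≡m⊖n h k with k ℕ.≤ᵇ h in k≤ᵇh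
... | true rewrite ⊖-≥ (≤ᵇ≡true⇒≤ k h k≤ᵇh) with atHeight k i (h ∸ k)
...   | true  = cong suc (downsAtHeightFrom≡downsWhere k i (h ∸ k) s p)
...   | false = downsAtHeightFrom≡downsWhere k i (h ∸ k) s p

isEven : ℕ → Bool
isEven y = y ℕ.% 2 ℕ.≡ᵇ 0

isEven-suc : ∀ y → isEven (suc y) ≡ not (isEven y)
isEven-suc zero          = refl
isEven-suc (suc zero)    = refl
isEven-suc (suc (suc y)) = isEven-suc y

isEven-double : ∀ h → isEven (h + h) ≡ true
isEven-double zero    = refl
isEven-double (suc h) rewrite +-suc h h = isEven-double h

atHeight-2-2 : ∀ y → atHeight 2 2 y ≡ isEven y
atHeight-2-2 zero          = refl
atHeight-2-2 (suc zero)    = refl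
atHeight-2-2 (suc (suc y)) = refl

atHeight-2-1 : ∀ y → atHeight 2 1 y ≡ not (isEven y)
atHeight-2-1 zero    = refl
atHeight-2-1 (suc y) = trans (sym (not-involutive (isEven y))) (cong not (sym (isEven-suc y)))

evenDowns : ℕ → List Step → ℕ
evenDowns = downsWhere isEven 2

-- The doubling bijection

double : List Step → List Step
double []      = []
double (U ∷ w) = U ∷ U ∷ double w
double (D ∷ w) = D ∷ double w

embed : List Step → List Step
embed w = U ∷ double w ++ U ∷ D ∷ []

double-dyckFrom : ∀ h w r → T (dyckFrom 1 h w) → dyckFrom 2 (suc (h + h)) (double w ++ r) ≡ dyckFrom 2 1 r
double-dyckFrom zero    []      r _ = refl
double-dyckFrom h       (U ∷ w) r p rewrite sym (+-suc h h) = double-dyckFrom (suc h) w r p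
double-dyckFrom (suc h) (D ∷ w) r p rewrite +-suc h h = double-dyckFrom h w r p

double-evenDowns : ∀ h w r → T (dyckFrom 1 h w) → evenDowns (suc (h + h)) (double w ++ r) ≡ evenDowns 1 r
double-evenDowns zero    []      r _ = refl
double-evenDowns h       (U ∷ w) r p rewrite sym (+-suc h h) = double-evenDowns (suc h) w r p
double-evenDowns (suc h) (D ∷ w) r p rewrite +-suc h h | isEven-suc (h + h) | isEven-double h =
  double-evenDowns h w r p

double-decompose : ∀ h s → T (dyckFrom 2 (suc (h + h)) s) → evenDowns (suc (h + h)) s ≡ 1 →
                   Σ (List Step) λ w → T (dyckFrom 1 h w) × double w ++ U ∷ D ∷ [] ≡ s
double-decompose (suc h) (D ∷ s) p e rewrite +-suc h h | isEven-suc (h + h) | isEven-double h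
  with w , q , refl ← double-decompose h s p e = D ∷ w , q , refl
double-decompose h (U ∷ U ∷ s) p e rewrite sym (+-suc h h)
  with w , q , refl ← double-decompose (suc h) s p e = U ∷ w , q , refl
double-decompose zero (U ∷ D ∷ []) p e = [] , _ , refl
double-decompose h (U ∷ D ∷ x ∷ s) p e rewrite isEven-double h =
  ⊥-elim (<⇒≢ (downsWhere-positive isEven 2 (h + h) x s _ p) (sym (suc-injective e)))

undouble : List Step → List Step
undouble (U ∷ U ∷ s) = U ∷ undouble s
undouble (D ∷ s)     = D ∷ undouble s
undouble _           = []

undouble-double : ∀ w → undouble (double w) ≡ w
undouble-double []      = refl
undouble-double (U ∷ w) = cong (U ∷_) (undouble-double w)
undouble-double (D ∷ w) = cong (D ∷_) (undouble-double w)

double-injective : ∀ {w w′} → double w ≡ double w′ → w ≡ w′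
double-injective {w} {w′} eq = begin
  w                    ≡⟨ undouble-double w ⟨
  undouble (double w)  ≡⟨ cong undouble eq ⟩
  undouble (double w′) ≡⟨ undouble-double w′ ⟩
  w′                   ∎
  where open ≡-Reasoning

embed-injective : ∀ {w w′} → embed w ≡ embed w′ → w ≡ w′
embed-injective eq = double-injective (++-cancelʳ (U ∷ D ∷ []) _ _ (∷-injectiveʳ eq))

length-double : ∀ w → length (double w) ≡ countU w + length w
length-double []      = refl
length-double (U ∷ w) = cong suc (trans (cong suc (length-double w)) (sym (+-suc (countU w) (length w))))
length-double (D ∷ w) = trans (cong suc (length-double w)) (sym (+-suc (countU w) (length w)))

length-embed : ∀ w → length (embed w) ≡ 3 + (countU w + length w)
length-embed w = begin
  suc (length (double w ++ U ∷ D ∷ [])) ≡⟨ cong suc (length-++ (double w)) ⟩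
  suc (length (double w) + 2)           ≡⟨ cong (λ n → suc (n + 2)) (length-double w) ⟩
  suc (countU w + length w + 2)         ≡⟨ cong suc (+-comm _ 2) ⟩
  3 + (countU w + length w)             ∎
  where open ≡-Reasoning

dyck-length : ∀ w → T (dyckFrom 1 0 w) → length w ≡ 2 * countU w
dyck-length w p = begin
  length w            ≡⟨ countU+countD≡length w ⟨
  countU w + countD w ≡⟨ cong (countU w +_) (trans (dyckFrom-balance 1 0 w p) (*-identityˡ _)) ⟨
  countU w + (countU w + 0) ≡⟨⟩
  2 * countU w        ∎
  where open ≡-Reasoning

dyck-length-embed : ∀ w → T (dyckFrom 1 0 w) → length (embed w) ≡ 3 * suc (countU w)
dyck-length-embed w p = begin
  length (embed w)              ≡⟨ length-embed w ⟩
  3 + (countU w + length w)     ≡⟨ cong (λ n → 3 + (countU w + n)) (dyck-length w p) ⟩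
  3 + (countU w + 2 * countU w) ≡⟨ 3+[c+2c]≡3[1+c] (countU w) ⟩
  3 * suc (countU w)            ∎
  where
  open ≡-Reasoning
  3+[c+2c]≡3[1+c] : ∀ c → 3 + (c + 2 * c) ≡ 3 * suc c
  3+[c+2c]≡3[1+c] = solve-∀

Dyck : ℕ → List Step → Set
Dyck m w = length w ≡ 2 * m × T (dyckFrom 1 0 w)

IsSpecial : List Step → Set
IsSpecial s = T (dyckFrom 2 0 s) × evenDowns 0 s ≡ 1

Special : ℕ → List Step → Set
Special m s = length s ≡ 3 * suc m × IsSpecial s

embed-↔ : ∀ m → Σ (List Step) (Dyck m) ↔ Σ (List Step) (Special m)
embed-↔ m = restriction-↔ {P = Dyck m} {Q = Special m}
  (×-irrelevant ≡-irrelevant T-irrelevant) (×-irrelevant ≡-irrelevant (×-irrelevant T-irrelevant ≡-irrelevant))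
  embed (λ {w} → embed-Special {w}) embed-injective embed-onto
  where
  embed-Special : ∀ {w} → Dyck m w → Special m (embed w)
  embed-Special {w} (len , p) =
    trans (dyck-length-embed w p) (cong (λ c → 3 * suc c) countU≡m) ,
    subst T (sym (double-dyckFrom 0 w _ p)) _ ,
    double-evenDowns 0 w _ p
    where
    countU≡m : countU w ≡ m
    countU≡m = *-cancelˡ-≡ _ _ 2 (trans (sym (dyck-length w p)) len)
  embed-onto : ∀ {s} → Special m s → Σ (List Step) λ w → Dyck m w × embed w ≡ s
  embed-onto {U ∷ s} (len , p , e) with w , q , refl ← double-decompose 0 s p e =
    w , (trans (dyck-length w q) (cong (2 *_) countU≡m) , q) , refl
    where
    countU≡m : countU w ≡ m
    countU≡m = suc-injective (*-cancelˡ-≡ _ _ 3 (trans (sym (dyck-length-embed w q)) len))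

-- The ballot numbers and the Catalan count

dyckCount : ℕ → ℕ → ℕ
dyckCount N h = count N (λ v → dyckFrom 1 h (toList v))

dyckCount-zero : ∀ N → dyckCount (suc N) 0 ≡ dyckCount N 1
dyckCount-zero N = trans (cong (dyckCount N 1 +_) (count-false N)) (+-identityʳ _)

-- If N + h = 2d, a path of length N from height h to 0 has d down-steps, and the
-- ballot formula says that C(N,d) − C(N,d+1) of them stay weakly above 0.
Ballot : ℕ → ℕ → ℕ → Set
Ballot N h d = dyckCount N h + N C suc d ≡ N C d

ballot-step : ∀ M h d → Ballot M (suc (suc h)) (suc d) → Ballot M h d → Ballot (suc M) (suc h) (suc d)
ballot-step M h d ih₁ ih₂ = begin
  (a + b) + suc M C suc (suc d)        ≡⟨ cong ((a + b) +_) (nCk+nC[k+1]≡[n+1]C[k+1] M (suc d)) ⟨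
  (a + b) + (M C suc d + M C suc (suc d)) ≡⟨ interchange a b (M C suc d) (M C suc (suc d)) ⟩
  (a + M C suc (suc d)) + (b + M C suc d) ≡⟨ cong₂ _+_ ih₁ ih₂ ⟩
  M C suc d + M C d                    ≡⟨ +-comm (M C suc d) (M C d) ⟩
  M C d + M C suc d                    ≡⟨ nCk+nC[k+1]≡[n+1]C[k+1] M d ⟩
  suc M C suc d                        ∎
  where
  open ≡-Reasoning
  a = dyckCount M (suc (suc h))
  b = dyckCount M h
  interchange : ∀ a b c e → (a + b) + (c + e) ≡ (a + e) + (b + c)
  interchange = solve-∀

ballot-step-zero : ∀ M d → M C d ≡ M C suc d → Ballot M 1 (suc d) → Ballot (suc M) 0 (suc d)
ballot-step-zero M d symmetric ih = begin
  dyckCount (suc M) 0 + suc M C suc (suc d) ≡⟨ cong₂ _+_ (dyckCount-zero M) (sym (nCk+nC[k+1]≡[n+1]C[k+1] M (suc d))) ⟩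
  a + (M C suc d + M C suc (suc d))         ≡⟨ x+[y+z]≡y+[x+z] a (M C suc d) _ ⟩
  M C suc d + (a + M C suc (suc d))         ≡⟨ cong₂ _+_ (sym symmetric) ih ⟩
  M C d + M C suc d                         ≡⟨ nCk+nC[k+1]≡[n+1]C[k+1] M d ⟩
  suc M C suc d                             ∎
  where
  open ≡-Reasoning
  a = dyckCount M 1
  x+[y+z]≡y+[x+z] : ∀ x y z → x + (y + z) ≡ y + (x + z)
  x+[y+z]≡y+[x+z] = solve-∀

ballot : ∀ N h d → N + h ≡ d + d → Ballot N h d
ballot zero    zero    zero    _  = refl
ballot zero    (suc h) (suc d) _  = refl
ballot (suc M) zero    (suc d) eq = ballot-step-zero M d symmetric (ballot M 1 (suc d) (trans (+-comm M 1) (cong suc M≡d+[1+d])))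
  where
  M≡d+[1+d] : M ≡ d + suc d
  M≡d+[1+d] = trans (sym (+-identityʳ M)) (suc-injective eq)
  symmetric : M C d ≡ M C suc d
  symmetric = trans (nCk≡nC[n∸k] (subst (d ≤_) (sym M≡d+[1+d]) (m≤m+n d (suc d))))
                    (cong (M C_) (trans (cong (_∸ d) M≡d+[1+d]) (m+n∸m≡n d (suc d))))
ballot (suc M) (suc h) (suc d) eq =
  ballot-step M h d (ballot M (suc (suc h)) (suc d) (trans (+-suc M (suc h)) eq))
              (ballot M h d (suc-injective (trans (sym (+-suc M h)) (trans (suc-injective eq) (+-suc d d)))))

absorption : ∀ n k → suc k * (suc n C suc k) ≡ suc n * (n C k)
absorption n       zero    = trans (+-identityʳ _) (trans (nC1≡n (suc n)) (sym (*-identityʳ (suc n))))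
absorption zero    (suc k) = *-zeroʳ (suc (suc k))
absorption (suc n) (suc k) = begin
  suc (suc k) * (suc (suc n) C suc (suc k)) ≡⟨ cong (suc (suc k) *_) (nCk+nC[k+1]≡[n+1]C[k+1] (suc n) (suc k)) ⟨
  suc (suc k) * (X + Y)                  ≡⟨ expand k X Y ⟩
  X + suc k * X + suc (suc k) * Y        ≡⟨ cong₂ (λ p q → X + p + q) (absorption n k) (absorption n (suc k)) ⟩
  X + suc n * a + suc n * b              ≡⟨ cong (λ x → x + suc n * a + suc n * b) (nCk+nC[k+1]≡[n+1]C[k+1] n k) ⟨
  (a + b) + suc n * a + suc n * b        ≡⟨ collect n a b ⟩
  suc (suc n) * (a + b)                  ≡⟨ cong (suc (suc n) *_) (nCk+nC[k+1]≡[n+1]C[k+1] n k) ⟩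
  suc (suc n) * X                        ∎
  where
  open ≡-Reasoning
  a = n C k
  b = n C suc k
  X = suc n C suc k
  Y = suc n C suc (suc k)
  expand : ∀ k X Y → suc (suc k) * (X + Y) ≡ X + suc k * X + suc (suc k) * Y
  expand = solve-∀
  collect : ∀ n a b → (a + b) + suc n * a + suc n * b ≡ suc (suc n) * (a + b)
  collect = solve-∀

catalan : ∀ m → suc m * dyckCount (m + m) 0 ≡ (m + m) C m
catalan m = +-cancelˡ-≡ (m * B) _ _ (begin
  m * B + suc m * c     ≡⟨ cong (_+ suc m * c) [1+m]*A≡m*B ⟨
  suc m * A + suc m * c ≡⟨ *-distribˡ-+ (suc m) A c ⟨
  suc m * (A + c)       ≡⟨ cong (suc m *_) (trans (+-comm A c) (ballot (m + m) 0 m (+-identityʳ (m + m)))) ⟩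
  suc m * B             ≡⟨ +-comm B (m * B) ⟩
  m * B + B             ∎)
  where
  open ≡-Reasoning
  c = dyckCount (m + m) 0
  A = (m + m) C suc m
  B = (m + m) C m
  [1+m]*A≡m*B : suc m * A ≡ m * B
  [1+m]*A≡m*B = +-cancelˡ-≡ (suc m * B) _ _ (begin
    suc m * B + suc m * A        ≡⟨ *-distribˡ-+ (suc m) B A ⟨
    suc m * (B + A)              ≡⟨ cong (suc m *_) (nCk+nC[k+1]≡[n+1]C[k+1] (m + m) m) ⟩
    suc m * (suc (m + m) C suc m) ≡⟨ absorption (m + m) m ⟩
    suc (m + m) * B              ≡⟨ split m B ⟩
    suc m * B + m * B            ∎)
    where
    split : ∀ m B → suc (m + m) * B ≡ suc m * B + m * B
    split = solve-∀

dyckCount≡catalan : ∀ m → dyckCount (2 * m) 0 ≡ ((2 * suc m ∸ 2) C m) / suc m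
dyckCount≡catalan m = begin
  dyckCount (2 * m) 0                   ≡⟨ cong (λ N → dyckCount N 0) 2*m≡m+m ⟩
  dyckCount (m + m) 0                   ≡⟨ m*n/n≡m (dyckCount (m + m) 0) (suc m) ⟨
  dyckCount (m + m) 0 * suc m / suc m   ≡⟨ cong (_/ suc m) (trans (*-comm _ (suc m)) (catalan m)) ⟩
  ((m + m) C m) / suc m                 ≡⟨ cong (λ N → (N C m) / suc m) (trans (sym 2*m≡m+m) (sym (cong (_∸ 2) (*-suc 2 m)))) ⟩
  ((2 * suc m ∸ 2) C m) / suc m         ∎
  where
  open ≡-Reasoning
  2*m≡m+m : 2 * m ≡ m + m
  2*m≡m+m = cong (m +_) (+-identityʳ m)

isKTDyck≡dyckFrom : ∀ k n (v : Vec Step (suc k * n)) → isKTDyck k 0 n v ≡ dyckFrom k 0 (toList v)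
isKTDyck≡dyckFrom k n v = trans
  (⌊⌋∧⌊⌋∧-implied (countD s ℕ.≟ n) (countU s ℕ.≟ k * n) _ (proj₁ ∘ counts) (proj₂ ∘ counts))
  (dyckFrom-correct k 0 s)
  where
  s = toList v
  counts = dyckFrom-counts k n s (length-toList v) ∘ subst T (dyckFrom-correct k 0 s)

isDyck≡dyckFrom : ∀ m (v : Vec Step (2 * m)) → isDyck m v ≡ dyckFrom 1 0 (toList v)
isDyck≡dyckFrom m v = trans
  (⌊⌋∧⌊⌋∧-implied (countD s ℕ.≟ m) (countU s ℕ.≟ m) _ (proj₁ ∘ counts) (λ t → trans (proj₂ (counts t)) (+-identityʳ m)))
  (dyckFrom-correct 1 0 s)
  where
  s = toList v
  counts = dyckFrom-counts 1 m s (length-toList v) ∘ subst T (dyckFrom-correct 1 0 s)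

heightConditions : ℕ → List Step → Bool
heightConditions m s = ⌊ downsAtHeight 2 1 s ℕ.≟ m ⌋ ∧ ⌊ downsAtHeight 2 2 s ℕ.≟ 1 ⌋

specialPath⇔ : ∀ m (v : Vec Step (3 * suc m)) →
               (T (isKTDyck 2 0 (suc m) v) × T (heightConditions m (toList v))) ⇔ IsSpecial (toList v)
specialPath⇔ m v = mk⇔
  (λ (p , c) → let q = subst T (isKTDyck≡dyckFrom 2 (suc m) v) p
               in q , trans (sym (evenDowns≡ q)) (proj₂ (to conditions⇔ c)))
  (λ (q , e) → subst T (sym (isKTDyck≡dyckFrom 2 (suc m) v)) q ,
               from conditions⇔ (oddDowns≡ q e , trans (evenDowns≡ q) e))
  where
  s = toList v
  conditions⇔ = T-⌊⌋∧⌊⌋ (downsAtHeight 2 1 s ℕ.≟ m) (downsAtHeight 2 2 s ℕ.≟ 1)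
  evenDowns≡ : T (dyckFrom 2 0 s) → downsAtHeight 2 2 s ≡ evenDowns 0 s
  evenDowns≡ q = trans (downsAtHeightFrom≡downsWhere 2 2 0 s q) (downsWhere-cong 2 0 s atHeight-2-2)
  oddDowns≡ : T (dyckFrom 2 0 s) → evenDowns 0 s ≡ 1 → downsAtHeight 2 1 s ≡ m
  oddDowns≡ q e = suc-injective (begin
    suc (downsAtHeight 2 1 s)                       ≡⟨ +-comm 1 _ ⟩
    downsAtHeight 2 1 s + 1                         ≡⟨ cong₂ _+_ oddDowns (sym e) ⟩
    downsWhere (not ∘ isEven) 2 0 s + evenDowns 0 s ≡⟨ +-comm _ (evenDowns 0 s) ⟩
    evenDowns 0 s + downsWhere (not ∘ isEven) 2 0 s ≡⟨ downsWhere+downsWhere-not isEven 2 0 s ⟩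
    countD s                                        ≡⟨ proj₁ (dyckFrom-counts 2 (suc m) s (length-toList v) q) ⟩
    suc m                                           ∎)
    where
    open ≡-Reasoning
    oddDowns : downsAtHeight 2 1 s ≡ downsWhere (not ∘ isEven) 2 0 s
    oddDowns = trans (downsAtHeightFrom≡downsWhere 2 1 0 s q) (downsWhere-cong 2 0 s atHeight-2-1)

dyckPath↔dyckVec : ∀ m → DyckPath m ↔ Σ (Vec Step (2 * m)) (T ∘ dyckFrom 1 0 ∘ toList)
dyckPath↔dyckVec m = Σ-cong-⇔ T-irrelevant T-irrelevant
  (λ {v} → mk⇔ (subst T (isDyck≡dyckFrom m v)) (subst T (sym (isDyck≡dyckFrom m v))))

specialPath↔dyckPath : ∀ m → SpecialPath (suc m) ↔ DyckPath m
specialPath↔dyckPath m = begin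
  SpecialPath (suc m)                                ↔⟨ Σ-assoc ⟩
  Σ (Vec Step (3 * suc m)) (λ v → T (isKTDyck 2 0 (suc m) v) × T (heightConditions m (toList v)))
                                                     ↔⟨ Σ-cong-⇔ (×-irrelevant T-irrelevant T-irrelevant)
                                                           (×-irrelevant T-irrelevant ≡-irrelevant) (λ {v} → specialPath⇔ m v) ⟩
  Σ (Vec Step (3 * suc m)) (IsSpecial ∘ toList)       ↔⟨ Σ-Vec↔Σ-List IsSpecial ⟩
  Σ (List Step) (Special m)                          ↔⟨ embed-↔ m ⟨
  Σ (List Step) (Dyck m)                             ↔⟨ Σ-Vec↔Σ-List (T ∘ dyckFrom 1 0) ⟨
  Σ (Vec Step (2 * m)) (T ∘ dyckFrom 1 0 ∘ toList)    ↔⟨ dyckPath↔dyckVec m ⟨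
  DyckPath m                                         ∎
  where open EquationalReasoning

dyckPath↔catalan : ∀ m → DyckPath m ↔ Fin (((2 * suc m ∸ 2) C m) / suc m)
dyckPath↔catalan m = subst (λ c → DyckPath m ↔ Fin c) (dyckCount≡catalan m)
  (enumerate (2 * m) (dyckFrom 1 0 ∘ toList) ↔-∘ dyckPath↔dyckVec m)

mainTheorem9 : (n : ℕ) .{{_ : NonZero n}} →
    (SpecialPath n ⤖ DyckPath (n ∸ 1)) ×
    (SpecialPath n ⤖ Fin (((2 * n ∸ 2) C (n ∸ 1)) / n))
mainTheorem9 (suc m) = ↔⇒⤖ (specialPath↔dyckPath m) , ↔⇒⤖ (dyckPath↔catalan m ↔-∘ specialPath↔dyckPath m)
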